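{- Let $t$ be a term and $n$ an integer with $n\ge\mathrm{rank}(t)$. If $t\to t'$ by a commutation reduction step (com1) or (com2), then $M_n(t')<M_n(t)$.
   Context: Pseudo-terms are given by the grammar $t ::= x \mid \lambda x.t \mid (t\,t') \mid\, !t \mid \mathrm{let}\ t\ \mathrm{be}\ !x\ \mathrm{in}\ t'$. In $\mathrm{let}\ u\ \mathrm{be}\ !x\ \mathrm{in}\ t_1$ the variable $x$ is bound in $t_1$: $FV(\mathrm{let}\ u\ \mathrm{be}\ !x\ \mathrm{in}\ t_1)=FV(u)\cup(FV(t_1)\setminus\{x\})$; $\lambda$ binds as usual. $FV(t)$ is the set of free variables of $t$, and $no(x,t)$ is the number of free occurrences of $x$ in $t$. Terms and their sets of temporary variables $TV(t)\subseteq FV(t)$ are defined simultaneously as the smallest set of pseudo-terms such that: (i) a variable $x$ is a term, $TV(x)=\emptyset$; (ii) $\lambda x.t$ is a term iff $t$ is a term, $x\notin TV(t)$ and $no(x,t)\le 1$, and then $TV(\lambda x.t)=TV(t)$; (iii) $(t_1\,t_2)$ is a term iff $t_1,t_2$ are terms, $TV(t_1)\cap FV(t_2)=\emptyset$ and $FV(t_1)\cap TV(t_2)=\emptyset$, and then $TV(t_1\,t_2)=TV(t_1)\cup TV(t_2)$; (iv) $!t$ is a term iff $t$ is a term, $TV(t)=\emptyset$ and $no(x,t)=1$ for all $x\in FV(t)$, and then $TV(!t)=FV(t)$; (v) $\mathrm{let}\ t_1\ \mathrm{be}\ !x\ \mathrm{in}\ t_2$ is a term iff $t_1,t_2$ are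 terms, $TV(t_1)\cap FV(t_2)=\emptyset$ and $FV(t_1)\cap TV(t_2)=\emptyset$, and then its $TV$ is $TV(t_1)\cup(TV(t_2)\setminus\{x\})$. Commutation steps, in any context: (com1) $\mathrm{let}\ (\mathrm{let}\ t_1\ \mathrm{be}\ !y\ \mathrm{in}\ t_2)\ \mathrm{be}\ !x\ \mathrm{in}\ t_3 \to \mathrm{let}\ t_1\ \mathrm{be}\ !y\ \mathrm{in}\ (\mathrm{let}\ t_2\ \mathrm{be}\ !x\ \mathrm{in}\ t_3)$; (com2) $((\mathrm{let}\ t_1\ \mathrm{be}\ !x\ \mathrm{in}\ t_2)\ t_3)\to \mathrm{let}\ t_1\ \mathrm{be}\ !x\ \mathrm{in}\ (t_2\,t_3)$. Rank: $\mathrm{rank}(x)=0$, $\mathrm{rank}(\lambda x.t)=\mathrm{rank}(t)$, $\mathrm{rank}(t_1\,t_2)=\max(\mathrm{rank}(t_1),\mathrm{rank}(t_2))$, $\mathrm{rank}(!t)=\mathrm{rank}(t)$, and $\mathrm{rank}(\mathrm{let}\ u\ \mathrm{be}\ !x\ \mathrm{in}\ t_1)$ equals $\max(\mathrm{rank}(u),\mathrm{rank}(t_1))$ if $x\in TV(t_1)$ and $\max(\mathrm{rank}(u),\mathrm{rank}(t_1),no(x,t_1))$ if $x\notin TV(t_1)$. Weight, for an integer $n$: $W_n(x)=1$, $W_n(\lambda x.t)=W_n(t)+1$, $W_n(!u)=n\,W_n(u)+1$, $W_n(t_1\,t_2)=W_n(t_1)+W_n(t_2)$, $W_n(\mathrm{let}\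 u\ \mathrm{be}\ !x\ \mathrm{in}\ t_1)=W_n(u)+W_n(t_1)$. Measure: for each subterm occurrence $t_1$ of $t$ which is a let expression $t_1=\mathrm{let}\ u\ \mathrm{be}\ !x\ \mathrm{in}\ t_2$, set $M_n(t_1,t)=W_n(t)-W_n(t_2)$; then $M_n(t)$ is the sum of $M_n(t_1,t)$ over all subterm occurrences $t_1$ of $t$ that are let expressions. -}

module Defs where

open import Data.Nat using (ℕ; zero; suc; _+_; _*_; _⊔_; _≤_; _≟_)
open import Data.Bool using (Bool; true; false; _∨_; _∧_; not; if_then_else_)
open import Data.List using (List; []; _∷_; _++_; map)
open import Data.Integer as ℤ using (ℤ; +_)
open import Relation.Nullary.Decidable using (⌊_⌋)
open import Relation.Binary.PropositionalEquality using (_≡_; _≢_)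

Var : Set
Var = ℕ

data PTerm : Set where
  var  : Var → PTerm
  lam  : Var → PTerm → PTerm
  app  : PTerm → PTerm → PTerm
  bang : PTerm → PTerm
  lett : PTerm → Var → PTerm → PTerm   -- lett u x t  =  let u be !x in t

no : Var → PTerm → ℕ
no x (var y)      = if ⌊ x ≟ y ⌋ then 1 else 0
no x (lam y t)    = if ⌊ x ≟ y ⌋ then 0 else no x t
no x (app t₁ t₂)  = no x t₁ + no x t₂
no x (bang t)     = no x t
no x (lett u y t) = no x u + (if ⌊ x ≟ y ⌋ then 0 else no x t)

_∈FV_ : Var → PTerm → Set
x ∈FV t = no x t ≢ 0

tv : Var → PTerm → Bool
tv x (var y)      = false
tv x (lam y t)    = tv x t
tv x (app t₁ t₂)  = tv x t₁ ∨ tv x t₂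
tv x (bang t)     = not ⌊ no x t ≟ 0 ⌋
tv x (lett u y t) = tv x u ∨ (tv x t ∧ not ⌊ x ≟ y ⌋)

_∈TV_ : Var → PTerm → Set
x ∈TV t = tv x t ≡ true

DisjTF : PTerm → PTerm → Set
DisjTF t₁ t₂ = ∀ x → x ∈TV t₁ → ¬FV x t₂
  where
  ¬FV : Var → PTerm → Set
  ¬FV x t = no x t ≡ 0

data IsTerm : PTerm → Set where
  t-var  : ∀ x → IsTerm (var x)
  t-lam  : ∀ x t → IsTerm t → tv x t ≡ false → no x t ≤ 1 → IsTerm (lam x t)
  t-app  : ∀ t₁ t₂ → IsTerm t₁ → IsTerm t₂ →
           DisjTF t₁ t₂ → DisjTF t₂ t₁ → IsTerm (app t₁ t₂)
  t-bang : ∀ t → IsTerm t → (∀ x → tv x t ≡ false) →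
           (∀ x → x ∈FV t → no x t ≡ 1) → IsTerm (bang t)
  t-let  : ∀ t₁ x t₂ → IsTerm t₁ → IsTerm t₂ →
           DisjTF t₁ t₂ → DisjTF t₂ t₁ → IsTerm (lett t₁ x t₂)

rank : PTerm → ℕ
rank (var x)      = 0
rank (lam x t)    = rank t
rank (app t₁ t₂)  = rank t₁ ⊔ rank t₂
rank (bang t)     = rank t
rank (lett u x t) = if tv x t then rank u ⊔ rank t else rank u ⊔ rank t ⊔ no x t

W : ℕ → PTerm → ℕ
W n (var x)      = 1
W n (lam x t)    = W n t + 1
W n (app t₁ t₂)  = W n t₁ + W n t₂
W n (bang u)     = n * W n u + 1
W n (lett u x t) = W n u + W n t

letBodies : PTerm → List PTerm
letBodies (var x)      = []
letBodies (lam x t)    = letBodies t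
letBodies (app t₁ t₂)  = letBodies t₁ ++ letBodies t₂
letBodies (bang t)     = letBodies t
letBodies (lett u x t) = t ∷ (letBodies u ++ letBodies t)

sumℤ : List ℤ → ℤ
sumℤ []       = + 0
sumℤ (z ∷ zs) = z ℤ.+ sumℤ zs

M : ℕ → PTerm → ℤ
M n t = sumℤ (map (λ t₂ → + W n t ℤ.- + W n t₂) (letBodies t))

_∉FV_ : Var → PTerm → Set
x ∉FV t = no x t ≡ 0

-- One commutation step (com1)/(com2) in any context.  The freshness side
-- conditions express the usual variable convention (no capture).
data _→c_ : PTerm → PTerm → Set where
  com1 : ∀ t₁ y t₂ x t₃ → y ∉FV t₃ →
         lett (lett t₁ y t₂) x t₃ →c lett t₁ y (lett t₂ x t₃)
  com2 : ∀ t₁ x t₂ t₃ → x ∉FV t₃ →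
         app (lett t₁ x t₂) t₃ →c lett t₁ x (app t₂ t₃)
  c-lam   : ∀ x {t t'} → t →c t' → lam x t →c lam x t'
  c-appˡ  : ∀ {t t'} u → t →c t' → app t u →c app t' u
  c-appʳ  : ∀ u {t t'} → t →c t' → app u t →c app u t'
  c-bang  : ∀ {t t'} → t →c t' → bang t →c bang t'
  c-letˡ  : ∀ {t t'} x u → t →c t' → lett t x u →c lett t' x u
  c-letʳ  : ∀ u x {t t'} → t →c t' → lett u x t →c lett u x t'

{-# OPTIONS --safe #-}
module Submission where

-- A commutation step only regroups the same constructors, so it preserves the weight W_n(t)
-- and the number of let occurrences, while M_n(t) is that number times W_n(t) minus the total
-- weight of the let bodies.  Both commutations enlarge exactly one body by the weight of t₃
-- (in com1 the body t₂ of the let binding y becomes let t₂ be !x in t₃; in com2 the body t₂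
-- becomes t₂ t₃), and weights are positive, so M_n strictly decreases.

open import Defs
open import Data.Nat as ℕ using (ℕ; _≤_; suc; _+_; _*_; z<s)
open import Data.Nat.Properties
  using (+-assoc; +-commutativeSemigroup; m<m+n; m≤m+n; m≤n+m; <-≤-trans; +-monoˡ-<; +-monoʳ-<)
import Data.Nat.Tactic.RingSolver as ℕ-Solver
open import Data.Nat.ListAction using (sum)
open import Data.Nat.ListAction.Properties using (sum-++)
open import Algebra.Properties.CommutativeSemigroup +-commutativeSemigroup using (xy∙z≈xz∙y)
open import Data.Integer as ℤ using (_<_; +<+)
import Data.Integer.Properties as ℤ
import Data.Integer.Tactic.RingSolver as ℤ-Solver
open import Data.List using (List; []; _∷_; _++_; map; length)
open import Data.List.Properties using (map-++; length-++; length-++-sucʳ; ++-assoc)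
open import Relation.Binary.PropositionalEquality
  using (_≡_; refl; sym; trans; cong; cong₂; module ≡-Reasoning)

0<W : ∀ n t → 0 ℕ.< W n t
0<W n (var x)      = z<s
0<W n (lam x t)    = <-≤-trans (0<W n t) (m≤m+n (W n t) 1)
0<W n (app t u)    = <-≤-trans (0<W n t) (m≤m+n (W n t) (W n u))
0<W n (bang u)     = <-≤-trans z<s (m≤n+m 1 (n * W n u))
0<W n (lett u x t) = <-≤-trans (0<W n u) (m≤m+n (W n u) (W n t))

W-→c : ∀ n {t t'} → t →c t' → W n t' ≡ W n t
W-→c n (com1 t₁ y t₂ x t₃ _) = sym (+-assoc (W n t₁) (W n t₂) (W n t₃))
W-→c n (com2 t₁ x t₂ t₃ _)   = sym (+-assoc (W n t₁) (W n t₂) (W n t₃))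
W-→c n (c-lam x s)           = cong (_+ 1) (W-→c n s)
W-→c n (c-appˡ u s)          = cong (_+ W n u) (W-→c n s)
W-→c n (c-appʳ u s)          = cong (W n u +_) (W-→c n s)
W-→c n (c-bang s)            = cong (λ w → n * w + 1) (W-→c n s)
W-→c n (c-letˡ x u s)        = cong (_+ W n u) (W-→c n s)
W-→c n (c-letʳ u x s)        = cong (W n u +_) (W-→c n s)

letBodies-com1 : ∀ t₁ y t₂ x t₃ →
  letBodies (lett (lett t₁ y t₂) x t₃) ≡ t₃ ∷ t₂ ∷ letBodies t₁ ++ letBodies t₂ ++ letBodies t₃
letBodies-com1 t₁ y t₂ x t₃ =
  cong (λ ts → t₃ ∷ t₂ ∷ ts) (++-assoc (letBodies t₁) (letBodies t₂) (letBodies t₃))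

letBodies-com2 : ∀ t₁ x t₂ t₃ →
  letBodies (app (lett t₁ x t₂) t₃) ≡ t₂ ∷ letBodies t₁ ++ letBodies t₂ ++ letBodies t₃
letBodies-com2 t₁ x t₂ t₃ =
  cong (t₂ ∷_) (++-assoc (letBodies t₁) (letBodies t₂) (letBodies t₃))

letCount : PTerm → ℕ
letCount t = length (letBodies t)

letCount-app : ∀ t u → letCount (app t u) ≡ letCount t + letCount u
letCount-app t u = length-++ (letBodies t)

letCount-lett : ∀ u x t → letCount (lett u x t) ≡ suc (letCount u + letCount t)
letCount-lett u x t = cong suc (length-++ (letBodies u))

letCount-→c : ∀ {t t'} → t →c t' → letCount t' ≡ letCount t
letCount-→c (com1 t₁ y t₂ x t₃ _) = begin
  suc (length (letBodies t₁ ++ t₃ ∷ letBodies t₂ ++ letBodies t₃))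
    ≡⟨ cong suc (length-++-sucʳ (letBodies t₁) t₃ (letBodies t₂ ++ letBodies t₃)) ⟩
  length (t₃ ∷ t₂ ∷ letBodies t₁ ++ letBodies t₂ ++ letBodies t₃)
    ≡⟨ cong length (letBodies-com1 t₁ y t₂ x t₃) ⟨
  letCount (lett (lett t₁ y t₂) x t₃) ∎
  where open ≡-Reasoning
letCount-→c (com2 t₁ x t₂ t₃ _) = sym (cong length (letBodies-com2 t₁ x t₂ t₃))
letCount-→c (c-lam x s) = letCount-→c s
letCount-→c (c-bang s)  = letCount-→c s
letCount-→c (c-appˡ {t} {t'} u s)
  rewrite letCount-app t' u | letCount-app t u = cong (_+ letCount u) (letCount-→c s)
letCount-→c (c-appʳ u {t} {t'} s)
  rewrite letCount-app u t' | letCount-app u t = cong (letCount u +_) (letCount-→c s)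
letCount-→c (c-letˡ {t} {t'} x u s)
  rewrite letCount-lett t' x u | letCount-lett t x u = cong (λ k → suc (k + letCount u)) (letCount-→c s)
letCount-→c (c-letʳ u x {t} {t'} s)
  rewrite letCount-lett u x t' | letCount-lett u x t = cong (λ k → suc (letCount u + k)) (letCount-→c s)

weightSum : ℕ → List PTerm → ℕ
weightSum n ts = sum (map (W n) ts)

weightSum-++ : ∀ n xs ys → weightSum n (xs ++ ys) ≡ weightSum n xs + weightSum n ys
weightSum-++ n xs ys = trans (cong sum (map-++ (W n) xs ys)) (sum-++ (map (W n) xs) (map (W n) ys))

bodyWeight : ℕ → PTerm → ℕ
bodyWeight n t = weightSum n (letBodies t)

bodyWeight-app : ∀ n t u → bodyWeight n (app t u) ≡ bodyWeight n t + bodyWeight n u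
bodyWeight-app n t u = weightSum-++ n (letBodies t) (letBodies u)

bodyWeight-lett : ∀ n u x t → bodyWeight n (lett u x t) ≡ W n t + (bodyWeight n u + bodyWeight n t)
bodyWeight-lett n u x t = cong (W n t +_) (weightSum-++ n (letBodies u) (letBodies t))

bodyWeight-com1 : ∀ n t₁ y t₂ x t₃ →
  bodyWeight n (lett t₁ y (lett t₂ x t₃)) ≡ bodyWeight n (lett (lett t₁ y t₂) x t₃) + W n t₃
bodyWeight-com1 n t₁ y t₂ x t₃ = begin
  W n t₂ + W n t₃ + weightSum n (L ++ t₃ ∷ R)
    ≡⟨ cong (W n t₂ + W n t₃ +_) (weightSum-++ n L (t₃ ∷ R)) ⟩
  W n t₂ + W n t₃ + (weightSum n L + (W n t₃ + weightSum n R))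
    ≡⟨ rearrange (W n t₂) (W n t₃) (weightSum n L) (weightSum n R) ⟩
  W n t₃ + (W n t₂ + (weightSum n L + weightSum n R)) + W n t₃
    ≡⟨ cong (λ s → W n t₃ + (W n t₂ + s) + W n t₃) (weightSum-++ n L R) ⟨
  weightSum n (t₃ ∷ t₂ ∷ L ++ R) + W n t₃
    ≡⟨ cong (λ ts → weightSum n ts + W n t₃) (letBodies-com1 t₁ y t₂ x t₃) ⟨
  bodyWeight n (lett (lett t₁ y t₂) x t₃) + W n t₃ ∎
  where
  open ≡-Reasoning
  L R : List PTerm
  L = letBodies t₁
  R = letBodies t₂ ++ letBodies t₃
  rearrange : ∀ a b l r → a + b + (l + (b + r)) ≡ b + (a + (l + r)) + b
  rearrange = ℕ-Solver.solve-∀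

bodyWeight-com2 : ∀ n t₁ x t₂ t₃ →
  bodyWeight n (lett t₁ x (app t₂ t₃)) ≡ bodyWeight n (app (lett t₁ x t₂) t₃) + W n t₃
bodyWeight-com2 n t₁ x t₂ t₃ = begin
  W n t₂ + W n t₃ + weightSum n (letBodies t₁ ++ letBodies t₂ ++ letBodies t₃)
    ≡⟨ xy∙z≈xz∙y (W n t₂) (W n t₃) _ ⟩
  weightSum n (t₂ ∷ letBodies t₁ ++ letBodies t₂ ++ letBodies t₃) + W n t₃
    ≡⟨ cong (λ ts → weightSum n ts + W n t₃) (letBodies-com2 t₁ x t₂ t₃) ⟨
  bodyWeight n (app (lett t₁ x t₂) t₃) + W n t₃ ∎
  where open ≡-Reasoning

bodyWeight-→c : ∀ n {t t'} → t →c t' → bodyWeight n t ℕ.< bodyWeight n t'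
bodyWeight-→c n (com1 t₁ y t₂ x t₃ _)
  rewrite bodyWeight-com1 n t₁ y t₂ x t₃ = m<m+n _ (0<W n t₃)
bodyWeight-→c n (com2 t₁ x t₂ t₃ _)
  rewrite bodyWeight-com2 n t₁ x t₂ t₃ = m<m+n _ (0<W n t₃)
bodyWeight-→c n (c-lam x s) = bodyWeight-→c n s
bodyWeight-→c n (c-bang s)  = bodyWeight-→c n s
bodyWeight-→c n (c-appˡ {t} {t'} u s)
  rewrite bodyWeight-app n t u | bodyWeight-app n t' u =
  +-monoˡ-< (bodyWeight n u) (bodyWeight-→c n s)
bodyWeight-→c n (c-appʳ u {t} {t'} s)
  rewrite bodyWeight-app n u t | bodyWeight-app n u t' =
  +-monoʳ-< (bodyWeight n u) (bodyWeight-→c n s)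
bodyWeight-→c n (c-letˡ {t} {t'} x u s)
  rewrite bodyWeight-lett n t x u | bodyWeight-lett n t' x u =
  +-monoʳ-< (W n u) (+-monoˡ-< (bodyWeight n u) (bodyWeight-→c n s))
bodyWeight-→c n (c-letʳ u x {t} {t'} s)
  rewrite bodyWeight-lett n u x t | bodyWeight-lett n u x t' | W-→c n s =
  +-monoʳ-< (W n t) (+-monoʳ-< (bodyWeight n u) (bodyWeight-→c n s))

sumℤ-map-minus : ∀ {A : Set} (c : ℕ) (f : A → ℕ) xs →
  sumℤ (map (λ x → ℤ.+ c ℤ.- ℤ.+ f x) xs) ≡ ℤ.+ (length xs * c) ℤ.- ℤ.+ sum (map f xs)
sumℤ-map-minus c f []       = refl
sumℤ-map-minus c f (x ∷ xs) = begin
  (ℤ.+ c ℤ.- ℤ.+ f x) ℤ.+ sumℤ (map (λ y → ℤ.+ c ℤ.- ℤ.+ f y) xs)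
    ≡⟨ cong (λ z → (ℤ.+ c ℤ.- ℤ.+ f x) ℤ.+ z) (sumℤ-map-minus c f xs) ⟩
  (ℤ.+ c ℤ.- ℤ.+ f x) ℤ.+ (ℤ.+ (length xs * c) ℤ.- ℤ.+ s)
    ≡⟨ interchange (ℤ.+ c) (ℤ.+ f x) (ℤ.+ (length xs * c)) (ℤ.+ s) ⟩
  (ℤ.+ c ℤ.+ ℤ.+ (length xs * c)) ℤ.- (ℤ.+ f x ℤ.+ ℤ.+ s)
    ≡⟨ cong₂ ℤ._-_ (ℤ.pos-+ c (length xs * c)) (ℤ.pos-+ (f x) s) ⟨
  ℤ.+ (c + length xs * c) ℤ.- ℤ.+ (f x + s) ∎
  where
  open ≡-Reasoning
  s : ℕ
  s = sum (map f xs)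
  interchange : ∀ a b c d → (a ℤ.- b) ℤ.+ (c ℤ.- d) ≡ (a ℤ.+ c) ℤ.- (b ℤ.+ d)
  interchange = ℤ-Solver.solve-∀

M-as-difference : ∀ n t → M n t ≡ ℤ.+ (letCount t * W n t) ℤ.- ℤ.+ bodyWeight n t
M-as-difference n t = sumℤ-map-minus (W n t) (W n) (letBodies t)

mainTheorem16 : ∀ (n : ℕ) (t t' : PTerm) → IsTerm t → rank t ≤ n →
    t →c t' → M n t' < M n t
mainTheorem16 n t t' _ _ step = begin-strict
  M n t'
    ≡⟨ M-as-difference n t' ⟩
  ℤ.+ (letCount t' * W n t') ℤ.- ℤ.+ bodyWeight n t'
    ≡⟨ cong (λ k → ℤ.+ k ℤ.- ℤ.+ bodyWeight n t') (cong₂ _*_ (letCount-→c step) (W-→c n step)) ⟩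
  ℤ.+ (letCount t * W n t) ℤ.- ℤ.+ bodyWeight n t'
    <⟨ ℤ.+-monoʳ-< (ℤ.+ (letCount t * W n t)) (ℤ.neg-mono-< (+<+ (bodyWeight-→c n step))) ⟩
  ℤ.+ (letCount t * W n t) ℤ.- ℤ.+ bodyWeight n t
    ≡⟨ M-as-difference n t ⟨
  M n t ∎
  where open ℤ.≤-Reasoning
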